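{- Let $T$ be an order tree and $G$ a $T$-graph of finite adhesion. If $t\in T$ is a limit, then the neighbours of $t$ that lie below $t$ form a cofinal chain of order type $\omega$ in $\mathring{\lceil t\rceil}$.
   Context: An order tree is a poset $(T,\le)$ with a unique minimal element in which every $\lceil t\rceil=\{t'\le t\}$ is well-ordered; $\mathring{\lceil t\rceil}=\lceil t\rceil\setminus\{t\}$. $t'$ is a successor of $t$ if $t<t'$ with no point strictly between; a point is a limit if it is not a successor of any point. The height of $t$ is the order type of $\mathring{\lceil t\rceil}$; $T^{\le\sigma}$ is the set of points of height at most $\sigma$. A graph $G$ is a $T$-graph if $V(G)=T$, endvertices of every edge are comparable in $T$, and for each $t$ the set of neighbours of $t$ below $t$ is cofinal in $\mathring{\lceil t\rceil}$. A $T$-graph has finite adhesion if for every limit ordinal $\sigma$ every component of $G-T^{\le\sigma}$ has finite neighbourhood. -}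

module Defs where

open import Level using (0ℓ)
open import Data.Nat as ℕ using (ℕ)
open import Data.Product using (Σ; ∃; ∃-syntax; _×_; _,_; proj₁)
open import Data.Sum using (_⊎_)
open import Data.List using (List)
open import Data.List.Membership.Propositional using (_∈_)
open import Relation.Nullary using (¬_)
open import Relation.Binary.PropositionalEquality using (_≡_; _≢_)
open import Relation.Binary.Structures using (IsPartialOrder)

Finite : {A : Set} → (A → Set) → Set
Finite {A} P = Σ (List A) λ xs → ∀ x → P x → x ∈ xs

record OrderTree : Set₁ where
  field
    Carrier        : Set
    _≤_            : Carrier → Carrier → Set
    isPartialOrder : IsPartialOrder _≡_ _≤_
    root           : Carrier
    root-minimal   : ∀ s → s ≤ root → s ≡ root
    root-unique    : ∀ m → (∀ s → s ≤ m → s ≡ m) → m ≡ root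
    -- every ⌈ t ⌉ = { t' | t' ≤ t } is well-ordered:
    -- totally ordered, and every inhabited subset has a least element
    down-total     : ∀ t a b → a ≤ t → b ≤ t → a ≤ b ⊎ b ≤ a
    down-wf        : ∀ t (P : Carrier → Set) →
                     (∃[ a ] (a ≤ t × P a)) →
                     ∃[ m ] (m ≤ t × P m × (∀ a → a ≤ t → P a → m ≤ a))

  infix 4 _<_
  _<_ : Carrier → Carrier → Set
  a < b = a ≤ b × a ≢ b

  IsSuccessorOf : Carrier → Carrier → Set
  IsSuccessorOf t' t = t < t' × ¬ (∃[ u ] (t < u × u < t'))

  IsLimit : Carrier → Set
  IsLimit t = ∀ s → ¬ IsSuccessorOf t s

  Below : Carrier → Set
  Below t = Σ Carrier λ s → s < t

-- Ordinals, represented by (strict) well-ordered sets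

record WellOrder : Set₁ where
  field
    W        : Set
    _≺_      : W → W → Set
    irrefl   : ∀ a → ¬ (a ≺ a)
    trans    : ∀ {a b c} → a ≺ b → b ≺ c → a ≺ c
    trichot  : ∀ a b → a ≺ b ⊎ a ≡ b ⊎ b ≺ a
    least    : (P : W → Set) → ∃ P → ∃[ m ] (P m × (∀ a → P a → ¬ (a ≺ m)))

IsLimitOrdinal : WellOrder → Set
IsLimitOrdinal σ = W × (∀ a → ∃[ b ] (a ≺ b))
  where open WellOrder σ

module _ (T : OrderTree) where
  open OrderTree T

  -- order type of ⌈ t ⌉̊ (the height of t) is ≤ σ:
  -- ⌈ t ⌉̊ is order-isomorphic to an initial segment of σ
  HeightLe : Carrier → WellOrder → Set
  HeightLe t σ =
    Σ (Below t → W) λ f →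
      (∀ (a b : Below t) → proj₁ a < proj₁ b → f a ≺ f b) ×
      (∀ (a : Below t) (w : W) → w ≺ f a → ∃[ b ] (f b ≡ w))
    where open WellOrder σ

  UpTo : WellOrder → Carrier → Set
  UpTo σ t = HeightLe t σ

  record TGraph : Set₁ where
    field
      _~_      : Carrier → Carrier → Set
      ~-sym    : ∀ {x y} → x ~ y → y ~ x
      ~-irrefl : ∀ x → ¬ (x ~ x)
      ~-comparable : ∀ {x y} → x ~ y → x ≤ y ⊎ y ≤ x
      ~-cofinal : ∀ t s → s < t → ∃[ u ] (s ≤ u × u < t × u ~ t)

    data Conn (X : Carrier → Set) : Carrier → Carrier → Set where
      here : ∀ {v} → ¬ X v → Conn X v v
      step : ∀ {u v w} → Conn X u v → v ~ w → ¬ X w → Conn X u w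

    Component : (Carrier → Set) → Carrier → Carrier → Set
    Component X v = Conn X v

    Neighbourhood : (Carrier → Set) → Carrier → Set
    Neighbourhood C x = ¬ C x × ∃[ y ] (C y × x ~ y)

    FiniteAdhesion : Set₁
    FiniteAdhesion =
      ∀ (σ : WellOrder) → IsLimitOrdinal σ →
      ∀ v → ¬ UpTo σ v → Finite (Neighbourhood (Component (UpTo σ) v))

    DownNbr : Carrier → Carrier → Set
    DownNbr t u = u < t × u ~ t

    CofinalωChain : Carrier → Set
    CofinalωChain t =
      Σ (ℕ → Carrier) λ f →
        (∀ n → DownNbr t (f n)) ×
        (∀ m n → m ℕ.< n → f m < f n) ×
        (∀ u → DownNbr t u → ∃[ n ] (f n ≡ u)) ×
        (∀ s → s < t → ∃[ n ] (s ≤ f n))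

-- Enumerate the down-neighbours of t greedily: each next one is the least down-neighbour above
-- the previous one, which exists because t is a limit and the down-neighbours are cofinal.
-- This lists, in increasing order, all down-neighbours up to the supremum m of the sequence.
-- If m were below t, then m would be a limit of nonzero height, every term of the sequence
-- would lie in T^{≤σ} for σ the height of m while t does not, so the infinitely many terms
-- would all be neighbours of the component of t in G - T^{≤σ}, contradicting finite adhesion.
{-# OPTIONS --safe #-}
module Submission where

open import Defs
open import Level using (0ℓ)
open import Axiom.ExcludedMiddle using (ExcludedMiddle)
open import Relation.Binary.PropositionalEquality using (_≢_)

open import Data.Nat as ℕ using (ℕ; zero; suc; s≤s)
import Data.Nat.Properties as ℕ
open import Data.Fin using (toℕ)
import Data.Fin.Properties as Fin
open import Data.List using (length; lookup)
open import Data.List.Relation.Unary.Any using (index)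
open import Data.List.Relation.Unary.Any.Properties using (lookup-index)
open import Data.Product using (Σ; ∃; ∃-syntax; _×_; _,_; proj₁; proj₂)
open import Data.Sum using (_⊎_; inj₁; inj₂)
open import Data.Unit using (⊤; tt)
open import Relation.Nullary using (¬_; yes; no; contradiction)
open import Relation.Nullary.Decidable using (recompute)
open import Relation.Binary.PropositionalEquality
  using (_≡_; refl; sym; trans; cong; subst; respˡ; respʳ)
open import Relation.Binary.Structures using (IsPartialOrder)
import Relation.Binary.Construct.NonStrictToStrict as NonStrictToStrict

Finite⇒¬ℕ-injection : {A : Set} {P : A → Set} → Finite P → (g : ℕ → A) →
                      (∀ {m n} → m ℕ.< n → g m ≢ g n) → ¬ (∀ n → P (g n))
Finite⇒¬ℕ-injection (xs , complete) g injective all-P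
  with i , j , i<j , same-index ← Fin.pigeonhole (ℕ.n<1+n (length xs))
                                   (λ i → index (complete _ (all-P (toℕ i))))
  = injective i<j (trans (lookup-index (complete _ (all-P (toℕ i))))
                    (trans (cong (lookup xs) same-index)
                      (sym (lookup-index (complete _ (all-P (toℕ j)))))))

module OrderTreeProperties (em : ExcludedMiddle 0ℓ) (T : OrderTree) where
  open OrderTree T
  open IsPartialOrder isPartialOrder
    using () renaming (refl to ≤-refl; trans to ≤-trans; antisym to ≤-antisym)
  private module Strict = NonStrictToStrict _≡_ _≤_

  <-trans : ∀ {a b c} → a < b → b < c → a < c
  <-trans = Strict.<-trans isPartialOrder

  <-≤-trans : ∀ {a b c} → a < b → b ≤ c → a < c
  <-≤-trans = Strict.<-≤-trans sym ≤-trans ≤-antisym (respʳ _≤_)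

  ≤-<-trans : ∀ {a b c} → a ≤ b → b < c → a < c
  ≤-<-trans = Strict.≤-<-trans ≤-trans ≤-antisym (respˡ _≤_)

  <⇒≱ : ∀ {a b} → a < b → ¬ (b ≤ a)
  <⇒≱ = Strict.<⇒≱ ≤-antisym

  root≤ : ∀ t → root ≤ t
  root≤ t with m , m≤t , _ , m-least ← down-wf t (λ _ → ⊤) (t , ≤-refl , tt)
    = subst (_≤ t) (root-unique m (λ s s≤m → ≤-antisym s≤m (m-least s (≤-trans s≤m m≤t) tt))) m≤t

  <⇒≢root : ∀ {a b} → a < b → b ≢ root
  <⇒≢root (a≤b , a≢b) refl = a≢b (root-minimal _ a≤b)

  limit-dense : ∀ {s t} → IsLimit t → s < t → ∃[ u ] (s < u × u < t)
  limit-dense {s} {t} t-limit s<t with em {∃[ u ] (s < u × u < t)}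
  ... | yes between = between
  ... | no  nothing = contradiction (s<t , nothing) (t-limit s)

  strictMono⇒¬shrinks : ∀ {t} (k : Below t → Below t) →
                        (∀ a b → proj₁ a < proj₁ b → proj₁ (k a) < proj₁ (k b)) →
                        ∀ a → ¬ (proj₁ (k a) < proj₁ a)
  strictMono⇒¬shrinks {t} k k-mono (a , a<t) ka<a
    with c , _ , (c<t , kc<c) , c-least ← down-wf t (λ c → Σ (c < t) λ c<t → proj₁ (k (c , c<t)) < c)
                                              (a , proj₁ a<t , a<t , ka<a)
    = <⇒≱ kc<c (c-least _ (proj₁ (proj₂ (k (c , c<t))))
                          (proj₂ (k (c , c<t)) , k-mono _ _ kc<c))

  -- The proof of point < m is irrelevant, so two points below m are equal as soon as their
  -- underlying vertices are; this is what makes the order on them trichotomous.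
  record Point-below (m : Carrier) : Set where
    constructor ⟨_,_⟩
    field
      point : Carrier
      .below : point < m
  open Point-below using (point)

  point< : ∀ {m} (w : Point-below m) → point w < m
  point< ⟨ _ , p<m ⟩ = recompute em p<m

  BelowOrder : Carrier → WellOrder
  BelowOrder m = record
    { W       = Point-below m
    ; _≺_     = λ v w → point v < point w
    ; irrefl  = λ _ → Strict.<-irrefl refl
    ; trans   = <-trans
    ; trichot = trichotomy
    ; least   = least
    }
    where
    trichotomy : ∀ v w → point v < point w ⊎ v ≡ w ⊎ point w < point v
    trichotomy v@(⟨ a , _ ⟩) w@(⟨ b , _ ⟩) with em {a ≡ b}
    ... | yes refl = inj₂ (inj₁ refl)
    ... | no  a≢b with down-total m a b (proj₁ (point< v)) (proj₁ (point< w))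
    ...   | inj₁ a≤b = inj₁ (a≤b , a≢b)
    ...   | inj₂ b≤a = inj₂ (inj₂ (b≤a , λ b≡a → a≢b (sym b≡a)))

    least : (P : Point-below m → Set) → ∃ P →
            ∃[ w ] (P w × (∀ v → P v → ¬ (point v < point w)))
    least P (w , Pw)
      with c , _ , (c<m , Pc) , c-least ← down-wf m (λ c → Σ (c < m) λ c<m → P ⟨ c , c<m ⟩)
                                             (point w , proj₁ (point< w) , point< w , Pw)
      = ⟨ c , c<m ⟩ , Pc , λ v Pv v<c → <⇒≱ v<c (c-least _ (proj₁ (point< v)) (point< v , Pv))

  BelowOrder-isLimit : ∀ {m} → IsLimit m → m ≢ root → IsLimitOrdinal (BelowOrder m)
  BelowOrder-isLimit m-limit m≢root =
      ⟨ root , (root≤ _ , λ root≡m → m≢root (sym root≡m)) ⟩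
    , λ w → let u , w<u , u<m = limit-dense m-limit (point< w) in ⟨ u , u<m ⟩ , w<u

  height≤-of-below : ∀ {a m} → a ≤ m → HeightLe T a (BelowOrder m)
  height≤-of-below a≤m =
      (λ (b , b<a) → ⟨ b , <-≤-trans b<a a≤m ⟩)
    , (λ _ _ b<c → b<c)
    , λ (b , b<a) w w<b → (point w , <-trans w<b b<a) , refl

  ¬height≤-of-above : ∀ {m t} → m < t → ¬ HeightLe T t (BelowOrder m)
  ¬height≤-of-above {m} {t} m<t (h , h-mono , _) =
    strictMono⇒¬shrinks k h-mono (m , m<t) (point< (h (m , m<t)))
    where
    k : Below t → Below t
    k a = point (h a) , <-trans (point< (h a)) m<t

  StrictlyIncreasing : (ℕ → Carrier) → Set
  StrictlyIncreasing g = ∀ {m n} → m ℕ.< n → g m < g n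

  UpperBound : (ℕ → Carrier) → Carrier → Set
  UpperBound g a = ∀ n → g n ≤ a

  IsSupremumBelow : Carrier → (ℕ → Carrier) → Carrier → Set
  IsSupremumBelow t g m = m ≤ t × UpperBound g m × (∀ a → a ≤ t → UpperBound g a → m ≤ a)

  supremum : ∀ {s t} (g : ℕ → Carrier) → s ≤ t → UpperBound g s →
             ∃[ m ] (m ≤ s × IsSupremumBelow t g m)
  supremum {s} {t} g s≤t s-bound
    with m , m≤t , m-bound , m-least ← down-wf t (UpperBound g) (s , s≤t , s-bound)
    = m , m-least s s≤t s-bound , m≤t , m-bound , m-least

  supremum-isLimit : ∀ {t m} (g : ℕ → Carrier) → StrictlyIncreasing g →
                     IsSupremumBelow t g m → IsLimit m
  supremum-isLimit {t} {m} g g-mono (m≤t , m-bound , m-least) s (s<m , nothing-between) =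
    <⇒≱ s<m (m-least s (≤-trans (proj₁ s<m) m≤t) s-bound)
    where
    s-bound : UpperBound g s
    s-bound n with down-total t (g n) s (≤-trans (m-bound n) m≤t) (≤-trans (proj₁ s<m) m≤t)
    ... | inj₁ gn≤s = gn≤s
    ... | inj₂ s≤gn = contradiction
          (g (suc n) , ≤-<-trans s≤gn (g-mono (ℕ.n<1+n n))
                     , <-≤-trans (g-mono (ℕ.n<1+n (suc n))) (m-bound (suc (suc n))))
          nothing-between

  module Enumeration {t : Carrier} (t-limit : IsLimit t) (t≢root : t ≢ root)
                     (D : Carrier → Set) (D⇒< : ∀ {u} → D u → u < t)
                     (D-cofinal : ∀ s → s < t → ∃[ u ] (s ≤ u × D u)) where

    record LeastInD (P : Carrier → Set) : Set where
      field
        element   : Carrier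
        ∈D        : D element
        satisfies : P element
        least     : ∀ c → D c → P c → element ≤ c
    open LeastInD

    leastInD : (P : Carrier → Set) → ∃[ c ] (D c × P c) → LeastInD P
    leastInD P (c , Dc , Pc)
      with b , _ , (Db , Pb) , b-least ← down-wf t (λ c → D c × P c) (c , proj₁ (D⇒< Dc) , Dc , Pc)
      = record { element = b ; ∈D = Db ; satisfies = Pb
               ; least = λ c Dc Pc → b-least c (proj₁ (D⇒< Dc)) (Dc , Pc) }

    D-above : ∀ {a} → a < t → ∃[ c ] (D c × a < c)
    D-above a<t =
      let u , a<u , u<t = limit-dense t-limit a<t
          c , u≤c , Dc  = D-cofinal u u<t
      in c , Dc , <-≤-trans a<u u≤c

    first : LeastInD (λ _ → ⊤)
    first = let c , _ , Dc = D-cofinal root (root≤ t , λ root≡t → t≢root (sym root≡t))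
            in leastInD _ (c , Dc , tt)

    next : ∀ {a} → a < t → LeastInD (a <_)
    next a<t = leastInD _ (D-above a<t)

    enum : ℕ → Carrier
    enum∈D : ∀ n → D (enum n)

    enum zero    = element first
    enum (suc n) = element (next (D⇒< (enum∈D n)))

    enum∈D zero    = ∈D first
    enum∈D (suc n) = ∈D (next (D⇒< (enum∈D n)))

    enum-step : ∀ n → enum n < enum (suc n)
    enum-step n = satisfies (next (D⇒< (enum∈D n)))

    enum-strictMono : StrictlyIncreasing enum
    enum-strictMono {m} {suc n} (s≤s m≤n) with ℕ.m≤n⇒m<n∨m≡n m≤n
    ... | inj₁ m<n  = <-trans (enum-strictMono m<n) (enum-step n)
    ... | inj₂ refl = enum-step n

    enum-covers : ∀ {u} n → D u → u ≤ enum n → ∃[ k ] (enum k ≡ u)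
    enum-covers zero Du u≤e = 0 , ≤-antisym (least first _ Du tt) u≤e
    enum-covers {u} (suc n) Du u≤e
      with down-total t u (enum n) (proj₁ (D⇒< Du)) (proj₁ (D⇒< (enum∈D n)))
    ... | inj₁ u≤en = enum-covers n Du u≤en
    ... | inj₂ en≤u with em {enum n ≡ u}
    ...   | yes en≡u = n , en≡u
    ...   | no  en≢u = suc n , ≤-antisym (least (next (D⇒< (enum∈D n))) u Du (en≤u , en≢u)) u≤e

module TGraphProperties (em : ExcludedMiddle 0ℓ) {T : OrderTree} (G : TGraph T) where
  open OrderTree T
  open TGraph G
  open OrderTreeProperties em T

  Conn-avoids : ∀ {X u v} → Conn X u v → ¬ X v
  Conn-avoids (here ¬Xv)     = ¬Xv
  Conn-avoids (step _ _ ¬Xw) = ¬Xw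

  adjacent⇒∈Neighbourhood : ∀ {X x v} → X x → x ~ v → ¬ X v →
                            Neighbourhood (Component X v) x
  adjacent⇒∈Neighbourhood Xx x~v ¬Xv = (λ v⇝x → Conn-avoids v⇝x Xx) , _ , here ¬Xv , x~v

  ¬downNbr-supremum-below : FiniteAdhesion → ∀ {t m} (g : ℕ → Carrier) →
                            (∀ n → DownNbr t (g n)) → StrictlyIncreasing g →
                            m < t → ¬ IsSupremumBelow t g m
  ¬downNbr-supremum-below finite-adhesion {t} {m} g g-down g-mono m<t m-sup@(_ , m-bound , _) =
    Finite⇒¬ℕ-injection (finite-adhesion σ σ-limit t t-high) g (λ i<j → proj₂ (g-mono i<j))
      (λ n → adjacent⇒∈Neighbourhood (height≤-of-below (m-bound n)) (proj₂ (g-down n)) t-high)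
    where
    σ : WellOrder
    σ = BelowOrder m

    σ-limit : IsLimitOrdinal σ
    σ-limit = BelowOrder-isLimit (supremum-isLimit g g-mono m-sup)
                (<⇒≢root (<-≤-trans (g-mono (ℕ.n<1+n 0)) (m-bound 1)))

    t-high : ¬ UpTo T σ t
    t-high = ¬height≤-of-above m<t

  increasing-downNbrs-cofinal : FiniteAdhesion → ∀ {t} (g : ℕ → Carrier) →
                                (∀ n → DownNbr t (g n)) → StrictlyIncreasing g →
                                ∀ s → s < t → ∃[ n ] (s ≤ g n)
  increasing-downNbrs-cofinal finite-adhesion {t} g g-down g-mono s s<t
    with em {∃[ n ] (s ≤ g n)}
  ... | yes reached  = reached
  ... | no unreached =
    let m , m≤s , m-sup = supremum g (proj₁ s<t) g-bounded
    in contradiction m-sup (¬downNbr-supremum-below finite-adhesion g g-down g-mono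
                              (≤-<-trans m≤s s<t))
    where
    g-bounded : UpperBound g s
    g-bounded n with down-total t (g n) s (proj₁ (proj₁ (g-down n))) (proj₁ s<t)
    ... | inj₁ gn≤s = gn≤s
    ... | inj₂ s≤gn = contradiction (n , s≤gn) unreached

lemma4p4 : ExcludedMiddle 0ℓ →
    (T : OrderTree) (G : TGraph T) → TGraph.FiniteAdhesion G →
    (t : OrderTree.Carrier T) → OrderTree.IsLimit T t → t ≢ OrderTree.root T →
    TGraph.CofinalωChain G t
lemma4p4 em T G finite-adhesion t t-limit t≢root =
  enum , enum∈D , (λ _ _ → enum-strictMono) , enum-onto , cofinal
  where
  open OrderTree T using (_<_; _≤_)
  open TGraph G
  open OrderTreeProperties em T
  open TGraphProperties em G
  open Enumeration t-limit t≢root (DownNbr t) proj₁ (~-cofinal t)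

  cofinal : ∀ s → s < t → ∃[ n ] (s ≤ enum n)
  cofinal = increasing-downNbrs-cofinal finite-adhesion enum enum∈D enum-strictMono

  enum-onto : ∀ u → DownNbr t u → ∃[ k ] (enum k ≡ u)
  enum-onto u u-down = let n , u≤en = cofinal u (proj₁ u-down) in enum-covers n u-down u≤en
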